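{- Let $K$ be a field of characteristic different from $2$ with algebraic closure $\overline{K}$, and let $f(z)=z^2-1$. For $n\ge 0$ and $w\in\overline{K}$, let $f^{ -n}(w)$ denote the set of roots in $\overline{K}$ of $f^n(z)=w$, where $f^n$ is the $n$-th iterate of $f$. Let $m\geq 0$ and let $y\in\overline{K}$ with $y\neq 0,-1$. Let $\alpha_{0,1}\in f^{ -1}(y)$ and put $\beta_{0,1}:=-\alpha_{0,1}$. For each $i=1,\ldots,m$, choose points $\{\alpha_{i,j},\beta_{i,j}: 1\le j\le 2^i\}\subseteq f^{ -(2i+1)}(y)$ such that for each $\ell=1,\ldots,2^{i-1}$, \[ f^{ -2}(\alpha_{i-1,\ell})=\{\pm\alpha_{i,2\ell-1},\pm\alpha_{i,2\ell}\}\quad\text{and}\quad f^{ -2}(\beta_{i-1,\ell})=\{\pm\beta_{i,2\ell-1},\pm\beta_{i,2\ell}\}. \] Define $\gamma_m:=\prod_{j=1}^{2^m}\alpha_{m,j}$ and $\delta_m:=\prod_{j=1}^{2^m}\beta_{m,j}$. Then $(-\gamma_m)^{2^m}=\beta_{0,1}$ and $(-\delta_m)^{2^m}=\alpha_{0,1}$. Moreover, $\gamma_m/\delta_m$ is a primitive $2^{m+1}$-th root of unity. -}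

module Defs where

open import Level using (Level; _⊔_) renaming (suc to lsuc)
open import Algebra.Bundles using (CommutativeRing)
open import Data.Nat using (ℕ; zero; suc; _<_)
open import Data.List using (List; []; _∷_; length)
open import Data.Product using (∃)
open import Relation.Nullary using (¬_)

record Field (c ℓ : Level) : Set (lsuc (c ⊔ ℓ)) where
  field
    commutativeRing : CommutativeRing c ℓ
  open CommutativeRing commutativeRing public
  field
    0≉1     : ¬ (0# ≈ 1#)
    inv     : (x : Carrier) → ¬ (x ≈ 0#) → Carrier
    inv-inv : (x : Carrier) (p : ¬ (x ≈ 0#)) → x * inv x p ≈ 1#

module FieldOps {c ℓ} (F : Field c ℓ) where
  open Field F

  infixr 8 _^_
  _^_ : Carrier → ℕ → Carrier
  x ^ zero  = 1#
  x ^ suc n = x * (x ^ n)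

  iter : ℕ → (Carrier → Carrier) → Carrier → Carrier
  iter zero    g x = x
  iter (suc n) g x = g (iter n g x)

  prod : ℕ → (ℕ → Carrier) → Carrier
  prod zero    a = 1#
  prod (suc n) a = prod n a * a n

  eval : List Carrier → Carrier → Carrier
  eval []       z = 0#
  eval (c ∷ cs) z = c + z * eval cs z

  IsAlgebraicallyClosed : Set (c ⊔ ℓ)
  IsAlgebraicallyClosed =
    (cs : List Carrier) → 0 < length cs →
    ∃ λ z → (z ^ length cs + eval cs z) ≈ 0#

  CharNot2 : Set ℓ
  CharNot2 = ¬ ((1# + 1#) ≈ 0#)

  IsPrimitiveRootOfUnity : ℕ → Carrier → Set ℓ
  IsPrimitiveRootOfUnity n ζ =
    (ζ ^ n ≈ 1#) × ((k : ℕ) → 0 < k → k < n → ¬ (ζ ^ k ≈ 1#))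
    where open import Data.Product using (_×_)

  f : Carrier → Carrier
  f z = z * z - 1#

-- If f⁻²(a) = {±u, ±v}, put s = f(u) and t = f(v).  The roots of f(e) = a are
-- exactly s and t (each is f of a square root of 1 + e), and this root set is
-- closed under negation, so t = -s when the characteristic is not 2.  Hence
-- (uv)² = (1 + s)(1 - s) = -f(s) = -a: the square of the product of two siblings
-- in the tree is minus their parent.  Iterating level by level,
-- (-γₘ)^(2^m) = -α₀ and (-δₘ)^(2^m) = -β₀ = α₀, so ζ = γₘ/δₘ satisfies
-- ζ^(2^m) = -1, which forces it to be a primitive 2^(m+1)-th root of unity.
module Submission where

open import Defs
open import Level using (Level; _⊔_)
open import Data.Nat as ℕ using (ℕ; zero; suc; _≤_; _<_; _∸_; z≤n; s≤s; NonZero)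
import Data.Nat.Properties as ℕₚ
open import Data.Nat.DivMod using (_divMod_; result)
open import Data.Fin using (zero; suc)
open import Data.List using (_∷_; [])
open import Data.Product using (_×_; Σ; ∃; _,_; proj₁; proj₂)
open import Data.Sum as Sum using (_⊎_; inj₁; inj₂)
open import Relation.Nullary using (¬_)
import Relation.Binary.PropositionalEquality as ≡
import Algebra.Properties.Ring as RingProperties
import Algebra.Properties.CommutativeSemigroup as CommutativeSemigroupProperties
import Algebra.Properties.CommutativeSemiring.Exp as ExpProperties

module FieldLemmas {c ℓ} (F : Field c ℓ) where
  open Field F
  open FieldOps F
  open RingProperties ring
  open CommutativeSemigroupProperties *-commutativeSemigroup using (interchange; x∙yz≈y∙xz)
  module Exp = ExpProperties commutativeSemiring
  open import Relation.Binary.Reasoning.Setoid setoid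

  inv-inverseˡ : ∀ {x} (x≉0 : ¬ x ≈ 0#) → inv x x≉0 * x ≈ 1#
  inv-inverseˡ {x} x≉0 = trans (*-comm _ x) (inv-inv x x≉0)

  *-cancelˡ-≉0 : ∀ {a} x y → ¬ a ≈ 0# → a * x ≈ a * y → x ≈ y
  *-cancelˡ-≉0 {a} x y a≉0 ax≈ay = begin
    x                      ≈⟨ *-identityˡ x ⟨
    1# * x                 ≈⟨ *-congʳ (inv-inverseˡ a≉0) ⟨
    (inv a a≉0 * a) * x    ≈⟨ *-assoc _ a x ⟩
    inv a a≉0 * (a * x)    ≈⟨ *-congˡ ax≈ay ⟩
    inv a a≉0 * (a * y)    ≈⟨ *-assoc _ a y ⟨
    (inv a a≉0 * a) * y    ≈⟨ *-congʳ (inv-inverseˡ a≉0) ⟩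
    1# * y                 ≈⟨ *-identityˡ y ⟩
    y                      ∎

  x≈-x⇒x≈0 : CharNot2 → ∀ {x} → x ≈ - x → x ≈ 0#
  x≈-x⇒x≈0 char≢2 {x} x≈-x = *-cancelˡ-≉0 x 0# char≢2 (begin
    (1# + 1#) * x     ≈⟨ distribʳ x 1# 1# ⟩
    1# * x + 1# * x   ≈⟨ +-cong (*-identityˡ x) (*-identityˡ x) ⟩
    x + x             ≈⟨ +-congʳ x≈-x ⟩
    - x + x           ≈⟨ -‿inverseˡ x ⟩
    0#                ≈⟨ zeroʳ _ ⟨
    (1# + 1#) * 0#    ∎)

  -1≉1 : CharNot2 → ¬ - 1# ≈ 1#
  -1≉1 char≢2 -1≈1 = 0≉1 (sym (x≈-x⇒x≈0 char≢2 (sym -1≈1)))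

  -x*-x≈x*x : ∀ x → (- x) * (- x) ≈ x * x
  -x*-x≈x*x x = begin
    (- x) * (- x)   ≈⟨ -‿distribˡ-* x (- x) ⟨
    - (x * - x)     ≈⟨ -‿cong (-‿distribʳ-* x x) ⟨
    - (- (x * x))   ≈⟨ -‿involutive (x * x) ⟩
    x * x           ∎

  ^≈^ᴱ : ∀ x n → x ^ n ≈ x Exp.^ n
  ^≈^ᴱ x zero    = refl
  ^≈^ᴱ x (suc n) = *-congˡ (^≈^ᴱ x n)

  ^-congˡ : ∀ n {x y} → x ≈ y → x ^ n ≈ y ^ n
  ^-congˡ zero    x≈y = refl
  ^-congˡ (suc n) x≈y = *-cong x≈y (^-congˡ n x≈y)

  ^-assocʳ : ∀ x m n → (x ^ m) ^ n ≈ x ^ (m ℕ.* n)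
  ^-assocʳ x m n = begin
    (x ^ m) ^ n          ≈⟨ ^≈^ᴱ (x ^ m) n ⟩
    (x ^ m) Exp.^ n      ≈⟨ Exp.^-congˡ n (^≈^ᴱ x m) ⟩
    (x Exp.^ m) Exp.^ n  ≈⟨ Exp.^-assocʳ x m n ⟩
    x Exp.^ (m ℕ.* n)    ≈⟨ ^≈^ᴱ x (m ℕ.* n) ⟨
    x ^ (m ℕ.* n)        ∎

  ^-distrib-* : ∀ x y n → (x * y) ^ n ≈ x ^ n * y ^ n
  ^-distrib-* x y n = begin
    (x * y) ^ n              ≈⟨ ^≈^ᴱ (x * y) n ⟩
    (x * y) Exp.^ n          ≈⟨ Exp.^-distrib-* x y n ⟩
    x Exp.^ n * y Exp.^ n    ≈⟨ *-cong (^≈^ᴱ x n) (^≈^ᴱ y n) ⟨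
    x ^ n * y ^ n            ∎

  1^n≈1 : ∀ n → 1# ^ n ≈ 1#
  1^n≈1 zero    = refl
  1^n≈1 (suc n) = trans (*-identityˡ _) (1^n≈1 n)

  0^n≈0 : ∀ n .{{_ : NonZero n}} → 0# ^ n ≈ 0#
  0^n≈0 (suc n) = zeroˡ _

  -1^2≈1 : (- 1#) ^ 2 ≈ 1#
  -1^2≈1 = trans (*-congˡ (*-identityʳ _)) (trans (-x*-x≈x*x 1#) (*-identityˡ 1#))

  -1^[q*2]≈1 : ∀ q → (- 1#) ^ (q ℕ.* 2) ≈ 1#
  -1^[q*2]≈1 q = begin
    (- 1#) ^ (q ℕ.* 2)   ≡⟨ ≡.cong ((- 1#) ^_) (ℕₚ.*-comm q 2) ⟩
    (- 1#) ^ (2 ℕ.* q)   ≈⟨ ^-assocʳ (- 1#) 2 q ⟨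
    ((- 1#) ^ 2) ^ q     ≈⟨ ^-congˡ q -1^2≈1 ⟩
    1# ^ q               ≈⟨ 1^n≈1 q ⟩
    1#                   ∎

  -1^n≈±1 : ∀ n → ((- 1#) ^ n ≈ 1#) ⊎ ((- 1#) ^ n ≈ - 1#)
  -1^n≈±1 zero    = inj₁ refl
  -1^n≈±1 (suc n) with -1^n≈±1 n
  ... | inj₁ ≈1  = inj₂ (trans (*-congˡ ≈1) (*-identityʳ _))
  ... | inj₂ ≈-1 = inj₁ (trans (*-congˡ ≈-1) (trans (-x*-x≈x*x 1#) (*-identityˡ 1#)))

  [-1^n]^n≈-1^n : ∀ n → ((- 1#) ^ n) ^ n ≈ (- 1#) ^ n
  [-1^n]^n≈-1^n n with -1^n≈±1 n
  ... | inj₁ ≈1  = trans (^-congˡ n ≈1) (trans (1^n≈1 n) (sym ≈1))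
  ... | inj₂ ≈-1 = ^-congˡ n ≈-1

  [-1^n*x]^n≈[-x]^n : ∀ n x → ((- 1#) ^ n * x) ^ n ≈ (- x) ^ n
  [-1^n*x]^n≈[-x]^n n x = begin
    ((- 1#) ^ n * x) ^ n         ≈⟨ ^-distrib-* _ x n ⟩
    ((- 1#) ^ n) ^ n * x ^ n     ≈⟨ *-congʳ ([-1^n]^n≈-1^n n) ⟩
    (- 1#) ^ n * x ^ n           ≈⟨ ^-distrib-* (- 1#) x n ⟨
    (- 1# * x) ^ n               ≈⟨ ^-congˡ n (-1*x≈-x x) ⟩
    (- x) ^ n                    ∎

  prod-cong : ∀ n {a b : ℕ → Carrier} → (∀ i → i < n → a i ≈ b i) → prod n a ≈ prod n b
  prod-cong zero    a≈b = refl
  prod-cong (suc n) a≈b =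
    *-cong (prod-cong n (λ i i<n → a≈b i (ℕₚ.m<n⇒m<1+n i<n))) (a≈b n ℕₚ.≤-refl)

  prod-distrib-* : ∀ n (a b : ℕ → Carrier) → prod n (λ i → a i * b i) ≈ prod n a * prod n b
  prod-distrib-* zero    a b = sym (*-identityˡ 1#)
  prod-distrib-* (suc n) a b =
    trans (*-congʳ (prod-distrib-* n a b)) (interchange (prod n a) (prod n b) (a n) (b n))

  prod-neg : ∀ n (a : ℕ → Carrier) → prod n (λ i → - a i) ≈ (- 1#) ^ n * prod n a
  prod-neg zero    a = sym (*-identityˡ 1#)
  prod-neg (suc n) a = begin
    prod n (λ i → - a i) * - a n             ≈⟨ *-cong (prod-neg n a) (sym (-1*x≈-x (a n))) ⟩
    ((- 1#) ^ n * prod n a) * (- 1# * a n)   ≈⟨ interchange _ (prod n a) (- 1#) (a n) ⟩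
    ((- 1#) ^ n * - 1#) * (prod n a * a n)   ≈⟨ *-congʳ (*-comm _ (- 1#)) ⟩
    (- 1#) ^ suc n * prod (suc n) a          ∎

  prod-pairs : ∀ n (a : ℕ → Carrier) →
    prod (2 ℕ.* n) a ≈ prod n (λ l → a (2 ℕ.* l) * a (2 ℕ.* l ℕ.+ 1))
  prod-pairs zero    a = refl
  prod-pairs (suc n) a = begin
    prod (2 ℕ.* suc n) a                                   ≡⟨ ≡.cong (λ k → prod k a) (ℕₚ.*-suc 2 n) ⟩
    (prod (2 ℕ.* n) a * a (2 ℕ.* n)) * a (suc (2 ℕ.* n))  ≈⟨ *-assoc _ _ _ ⟩
    prod (2 ℕ.* n) a * (a (2 ℕ.* n) * a (suc (2 ℕ.* n)))  ≡⟨ ≡.cong (λ k → prod (2 ℕ.* n) a * (a (2 ℕ.* n) * a k))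
                                                                     (ℕₚ.+-comm 1 (2 ℕ.* n)) ⟩
    prod (2 ℕ.* n) a * (a (2 ℕ.* n) * a (2 ℕ.* n ℕ.+ 1))  ≈⟨ *-congʳ (prod-pairs n a) ⟩
    prod (suc n) (λ l → a (2 ℕ.* l) * a (2 ℕ.* l ℕ.+ 1))  ∎

  square-root : IsAlgebraicallyClosed → ∀ x → ∃ λ z → z * z ≈ x
  square-root closed x with closed (- x ∷ 0# ∷ []) (s≤s z≤n)
  ... | z , root = z , x∙y⁻¹≈ε⇒x≈y (z * z) x (begin
    z * z - x                            ≈⟨ +-cong (*-congˡ (*-identityʳ z)) (+-identityʳ (- x)) ⟨
    z ^ 2 + (- x + 0#)                   ≈⟨ +-congˡ (+-congˡ linear-term≈0) ⟨
    z ^ 2 + eval (- x ∷ 0# ∷ []) z       ≈⟨ root ⟩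
    0#                                   ∎)
    where
    linear-term≈0 : z * (0# + z * 0#) ≈ 0#
    linear-term≈0 = trans (*-congˡ (trans (+-identityˡ _) (zeroʳ z))) (zeroʳ z)

  f-cong : ∀ {x y} → x ≈ y → f x ≈ f y
  f-cong x≈y = +-congʳ (*-cong x≈y x≈y)

  f-neg : ∀ x → f (- x) ≈ f x
  f-neg x = +-congʳ (-x*-x≈x*x x)

  1+f[x]≈x*x : ∀ x → 1# + f x ≈ x * x
  1+f[x]≈x*x x = trans (sym (+-assoc 1# (x * x) (- 1#))) (xyx⁻¹≈y 1# (x * x))

  [1+x][1-x]≈-f[x] : ∀ x → (1# + x) * (1# - x) ≈ - f x
  [1+x][1-x]≈-f[x] x = begin
    (1# + x) * (1# - x)            ≈⟨ distribʳ (1# - x) 1# x ⟩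
    1# * (1# - x) + x * (1# - x)   ≈⟨ +-cong (*-identityˡ _) (x[y-z]≈xy-xz x 1# x) ⟩
    (1# - x) + (x * 1# - x * x)    ≈⟨ +-congˡ (+-congʳ (*-identityʳ x)) ⟩
    (1# - x) + (x - x * x)         ≈⟨ +-assoc 1# (- x) _ ⟩
    1# + (- x + (x - x * x))       ≈⟨ +-congˡ (+-assoc (- x) x _) ⟨
    1# + ((- x + x) - x * x)       ≈⟨ +-congˡ (+-congʳ (-‿inverseˡ x)) ⟩
    1# + (0# - x * x)              ≈⟨ +-congˡ (+-identityˡ _) ⟩
    1# - x * x                     ≈⟨ +-congʳ (-‿involutive 1#) ⟨
    - (- 1#) - x * x               ≈⟨ -‿anti-homo-+ (x * x) (- 1#) ⟨
    - f x                          ∎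

  f[x]≈y⇒x≉0 : ∀ {x y} → f x ≈ y → ¬ y ≈ - 1# → ¬ x ≈ 0#
  f[x]≈y⇒x≉0 {x} {y} fx≈y y≉-1 x≈0 = y≉-1 (begin
    y              ≈⟨ fx≈y ⟨
    f x            ≈⟨ f-cong x≈0 ⟩
    0# * 0# - 1#   ≈⟨ +-congʳ (zeroˡ 0#) ⟩
    0# - 1#        ≈⟨ +-identityˡ (- 1#) ⟩
    - 1#           ∎)

  neg-closed⊆pair⇒+≈0 : CharNot2 → ∀ {p} (P : Carrier → Set p) {s t} →
    (∀ {e} → P e → P (- e)) → (∀ {e} → P e → (e ≈ s) ⊎ (e ≈ t)) →
    P s → P t → s + t ≈ 0#
  neg-closed⊆pair⇒+≈0 char≢2 P {s} {t} neg ⊆pair Ps Pt with ⊆pair (neg Pt) | ⊆pair (neg Ps)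
  ... | inj₁ -t≈s | _        = trans (+-congʳ (sym -t≈s)) (-‿inverseˡ t)
  ... | inj₂ _    | inj₂ -s≈t = trans (+-congˡ (sym -s≈t)) (-‿inverseʳ s)
  ... | inj₂ -t≈t | inj₁ -s≈s =
    trans (+-cong (x≈-x⇒x≈0 char≢2 (sym -s≈s)) (x≈-x⇒x≈0 char≢2 (sym -t≈t))) (+-identityʳ 0#)

  infix 4 _∈±[_,_]
  _∈±[_,_] : Carrier → Carrier → Carrier → Set ℓ
  z ∈±[ u , v ] = (z ≈ u) ⊎ (z ≈ - u) ⊎ (z ≈ v) ⊎ (z ≈ - v)

  f∘f⁻¹[_]≈±[_,_] : Carrier → Carrier → Carrier → Set (c ⊔ ℓ)
  f∘f⁻¹[ a ]≈±[ u , v ] = ∀ z → (f (f z) ≈ a → z ∈±[ u , v ]) × (z ∈±[ u , v ] → f (f z) ≈ a)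

  ∈±⇒square : ∀ {z u v} → z ∈±[ u , v ] → (z * z ≈ u * u) ⊎ (z * z ≈ v * v)
  ∈±⇒square (inj₁ z≈u)                 = inj₁ (*-cong z≈u z≈u)
  ∈±⇒square (inj₂ (inj₁ z≈-u))         = inj₁ (trans (*-cong z≈-u z≈-u) (-x*-x≈x*x _))
  ∈±⇒square (inj₂ (inj₂ (inj₁ z≈v)))   = inj₂ (*-cong z≈v z≈v)
  ∈±⇒square (inj₂ (inj₂ (inj₂ z≈-v)))  = inj₂ (trans (*-cong z≈-v z≈-v) (-x*-x≈x*x _))

  IsPreimageTree : ℕ → (ℕ → ℕ → Carrier) → Set (c ⊔ ℓ)
  IsPreimageTree m α = ∀ i l → 1 ≤ i → i ≤ m → l < 2 ℕ.^ (i ∸ 1) →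
    f∘f⁻¹[ α (i ∸ 1) l ]≈±[ α i (2 ℕ.* l) , α i (2 ℕ.* l ℕ.+ 1) ]

  levelProd : (ℕ → ℕ → Carrier) → ℕ → Carrier
  levelProd α k = prod (2 ℕ.^ k) (α k)

  module _ (char≢2 : CharNot2) (√ : ∀ x → ∃ λ z → z * z ≈ x) where

    uv*uv≈-a : ∀ {a u v} → f∘f⁻¹[ a ]≈±[ u , v ] → (u * v) * (u * v) ≈ - a
    uv*uv≈-a {a} {u} {v} preimage = begin
      (u * v) * (u * v)          ≈⟨ interchange u v u v ⟩
      (u * u) * (v * v)          ≈⟨ *-cong (1+f[x]≈x*x u) (1+f[x]≈x*x v) ⟨
      (1# + f u) * (1# + f v)    ≈⟨ *-congˡ (+-congˡ (+-inverseʳ-unique (f u) (f v) fu+fv≈0)) ⟩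
      (1# + f u) * (1# - f u)    ≈⟨ [1+x][1-x]≈-f[x] (f u) ⟩
      - f (f u)                  ≈⟨ -‿cong (proj₂ (preimage u) (inj₁ refl)) ⟩
      - a                        ∎
      where
      Root : Carrier → Set ℓ
      Root e = f e ≈ a

      -- e = f z for a square root z of 1 + e, and then z ∈ {±u, ±v}
      roots⊆ : ∀ {e} → Root e → (e ≈ f u) ⊎ (e ≈ f v)
      roots⊆ {e} fe≈a with √ (1# + e)
      ... | z , z*z≈1+e = Sum.map e≈f e≈f (∈±⇒square (proj₁ (preimage z) ff[z]≈a))
        where
        ff[z]≈a : f (f z) ≈ a
        ff[z]≈a = trans (f-cong (+-cancelˡ 1# (f z) e (trans (1+f[x]≈x*x z) z*z≈1+e))) fe≈a

        e≈f : ∀ {w} → z * z ≈ w * w → e ≈ f w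
        e≈f {w} z*z≈w*w =
          +-cancelˡ 1# e (f w) (trans (sym z*z≈1+e) (trans z*z≈w*w (sym (1+f[x]≈x*x w))))

      fu+fv≈0 : f u + f v ≈ 0#
      fu+fv≈0 = neg-closed⊆pair⇒+≈0 char≢2 Root (λ {e} → trans (f-neg e)) roots⊆
        (proj₂ (preimage u) (inj₁ refl)) (proj₂ (preimage v) (inj₂ (inj₂ (inj₁ refl))))

    module _ {m} (α : ℕ → ℕ → Carrier) (tree : IsPreimageTree m α) where

      levelProd-square : ∀ {k} → suc k ≤ m →
        levelProd α (suc k) * levelProd α (suc k) ≈ (- 1#) ^ (2 ℕ.^ k) * levelProd α k
      levelProd-square {k} k<m = begin
        levelProd α (suc k) * levelProd α (suc k)
          ≈⟨ *-cong (prod-pairs N (α (suc k))) (prod-pairs N (α (suc k))) ⟩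
        prod N siblings * prod N siblings
          ≈⟨ prod-distrib-* N siblings siblings ⟨
        prod N (λ l → siblings l * siblings l)
          ≈⟨ prod-cong N (λ l l<N → uv*uv≈-a (tree (suc k) l (s≤s z≤n) k<m l<N)) ⟩
        prod N (λ l → - α k l)
          ≈⟨ prod-neg N (α k) ⟩
        (- 1#) ^ N * levelProd α k
          ∎
        where
        N : ℕ
        N = 2 ℕ.^ k

        siblings : ℕ → Carrier
        siblings l = α (suc k) (2 ℕ.* l) * α (suc k) (2 ℕ.* l ℕ.+ 1)

      [-levelProd]^[2^k]≈-α₀ : ∀ {k} → k ≤ m → (- levelProd α k) ^ (2 ℕ.^ k) ≈ - α 0 0
      [-levelProd]^[2^k]≈-α₀ {zero}  _   = trans (*-identityʳ _) (-‿cong (*-identityˡ _))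
      [-levelProd]^[2^k]≈-α₀ {suc k} k<m = begin
        (- levelProd α (suc k)) ^ (2 ℕ.* N)   ≈⟨ ^-assocʳ _ 2 N ⟨
        ((- levelProd α (suc k)) ^ 2) ^ N     ≈⟨ ^-congˡ N square ⟩
        ((- 1#) ^ N * levelProd α k) ^ N      ≈⟨ [-1^n*x]^n≈[-x]^n N (levelProd α k) ⟩
        (- levelProd α k) ^ N                 ≈⟨ [-levelProd]^[2^k]≈-α₀ (ℕₚ.<⇒≤ k<m) ⟩
        - α 0 0                               ∎
        where
        N : ℕ
        N = 2 ℕ.^ k

        square : (- levelProd α (suc k)) ^ 2 ≈ (- 1#) ^ N * levelProd α k
        square = trans (*-congˡ (*-identityʳ _)) (trans (-x*-x≈x*x _) (levelProd-square k<m))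

  -- an odd exponent k gives -1 ≈ (ζ^(2^m))^k ≈ (ζ^k)^(2^m) ≈ 1; an even one
  -- passes to ζ², whose 2^(m-1)-th power is again -1
  ^[2^m]≈-1⇒^k≉1 : CharNot2 → ∀ m {ζ} → ζ ^ (2 ℕ.^ m) ≈ - 1# →
    ∀ k → 0 < k → k < 2 ℕ.^ suc m → ¬ ζ ^ k ≈ 1#
  ^[2^m]≈-1⇒^k≉1 char≢2 m {ζ} ζ^M≈-1 k 0<k k<2M ζ^k≈1 with k divMod 2
  ^[2^m]≈-1⇒^k≉1 char≢2 m       _ _ ()  _             _ | result zero    zero ≡.refl
  ^[2^m]≈-1⇒^k≉1 char≢2 zero    _ _ _   (s≤s (s≤s ())) _ | result (suc q) zero ≡.refl
  ^[2^m]≈-1⇒^k≉1 char≢2 (suc m) {ζ} ζ^M≈-1 _ _ k<2M ζ^k≈1 | result (suc q) zero ≡.refl =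
    ^[2^m]≈-1⇒^k≉1 char≢2 m (trans (^-assocʳ ζ 2 (2 ℕ.^ m)) ζ^M≈-1) (suc q) (s≤s z≤n)
      (ℕₚ.*-cancelʳ-< 2 (suc q) (2 ℕ.^ suc m)
        (≡.subst (suc q ℕ.* 2 <_) (ℕₚ.*-comm 2 (2 ℕ.^ suc m)) k<2M))
      (begin
        (ζ ^ 2) ^ suc q       ≈⟨ ^-assocʳ ζ 2 (suc q) ⟩
        ζ ^ (2 ℕ.* suc q)     ≡⟨ ≡.cong (ζ ^_) (ℕₚ.*-comm 2 (suc q)) ⟩
        ζ ^ (suc q ℕ.* 2)     ≈⟨ ζ^k≈1 ⟩
        1#                    ∎)
  ^[2^m]≈-1⇒^k≉1 char≢2 m {ζ} ζ^M≈-1 _ _ _ ζ^k≈1 | result q (suc zero) ≡.refl =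
    -1≉1 char≢2 (begin
      - 1#                           ≈⟨ *-identityʳ _ ⟨
      - 1# * 1#                      ≈⟨ *-congˡ (-1^[q*2]≈1 q) ⟨
      (- 1#) ^ k                     ≈⟨ ^-congˡ k ζ^M≈-1 ⟨
      (ζ ^ M) ^ k                    ≈⟨ ^-assocʳ ζ M k ⟩
      ζ ^ (M ℕ.* k)                  ≡⟨ ≡.cong (ζ ^_) (ℕₚ.*-comm M k) ⟩
      ζ ^ (k ℕ.* M)                  ≈⟨ ^-assocʳ ζ k M ⟨
      (ζ ^ k) ^ M                    ≈⟨ ^-congˡ M ζ^k≈1 ⟩
      1# ^ M                         ≈⟨ 1^n≈1 M ⟩
      1#                             ∎)
    where
    M k : ℕ
    M = 2 ℕ.^ m
    k = suc (q ℕ.* 2)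

  ^[2^m]≈-1⇒primitive : CharNot2 → ∀ m {ζ} → ζ ^ (2 ℕ.^ m) ≈ - 1# →
    IsPrimitiveRootOfUnity (2 ℕ.^ suc m) ζ
  ^[2^m]≈-1⇒primitive char≢2 m {ζ} ζ^N≈-1 = ζ^2N≈1 , ^[2^m]≈-1⇒^k≉1 char≢2 m ζ^N≈-1
    where
    ζ^2N≈1 : ζ ^ (2 ℕ.^ suc m) ≈ 1#
    ζ^2N≈1 = begin
      ζ ^ (2 ℕ.* 2 ℕ.^ m)   ≡⟨ ≡.cong (ζ ^_) (ℕₚ.*-comm 2 (2 ℕ.^ m)) ⟩
      ζ ^ (2 ℕ.^ m ℕ.* 2)   ≈⟨ ^-assocʳ ζ (2 ℕ.^ m) 2 ⟨
      (ζ ^ (2 ℕ.^ m)) ^ 2   ≈⟨ ^-congˡ 2 ζ^N≈-1 ⟩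
      (- 1#) ^ 2            ≈⟨ -1^2≈1 ⟩
      1#                    ∎

  ratio-primitive : CharNot2 → ∀ m {a γ δ} → ¬ a ≈ 0# →
    (- γ) ^ (2 ℕ.^ m) ≈ - a → (- δ) ^ (2 ℕ.^ m) ≈ a →
    Σ (¬ δ ≈ 0#) λ δ≉0 → IsPrimitiveRootOfUnity (2 ℕ.^ suc m) (γ * inv δ δ≉0)
  ratio-primitive char≢2 m {a} {γ} {δ} a≉0 [-γ]^N≈-a [-δ]^N≈a =
    δ≉0 , ^[2^m]≈-1⇒primitive char≢2 m (*-cancelˡ-≉0 _ _ a≉0 a*ζ^N≈a*-1)
    where
    N : ℕ
    N = 2 ℕ.^ m

    instance
      N≢0 : NonZero N
      N≢0 = ℕₚ.m^n≢0 2 m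

    δ≉0 : ¬ δ ≈ 0#
    δ≉0 δ≈0 = a≉0 (begin
      a           ≈⟨ [-δ]^N≈a ⟨
      (- δ) ^ N   ≈⟨ ^-congˡ N (trans (-‿cong δ≈0) -0#≈0#) ⟩
      0# ^ N      ≈⟨ 0^n≈0 N ⟩
      0#          ∎)

    ζ : Carrier
    ζ = γ * inv δ δ≉0

    -δ*ζ≈-γ : - δ * ζ ≈ - γ
    -δ*ζ≈-γ = begin
      - δ * ζ                   ≈⟨ -‿distribˡ-* δ ζ ⟨
      - (δ * (γ * inv δ δ≉0))   ≈⟨ -‿cong (x∙yz≈y∙xz δ γ _) ⟩
      - (γ * (δ * inv δ δ≉0))   ≈⟨ -‿cong (*-congˡ (inv-inv δ δ≉0)) ⟩
      - (γ * 1#)                ≈⟨ -‿cong (*-identityʳ γ) ⟩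
      - γ                       ∎

    a*ζ^N≈a*-1 : a * ζ ^ N ≈ a * - 1#
    a*ζ^N≈a*-1 = begin
      a * ζ ^ N           ≈⟨ *-congʳ [-δ]^N≈a ⟨
      (- δ) ^ N * ζ ^ N   ≈⟨ ^-distrib-* (- δ) ζ N ⟨
      (- δ * ζ) ^ N       ≈⟨ ^-congˡ N -δ*ζ≈-γ ⟩
      (- γ) ^ N           ≈⟨ [-γ]^N≈-a ⟩
      - a                 ≈⟨ -‿cong (*-identityʳ a) ⟨
      - (a * 1#)          ≈⟨ -‿distribʳ-* a 1# ⟩
      a * - 1#            ∎

lemma1p2 : {c ℓ : Level} (F : Field c ℓ) →
  let open Field F
      open FieldOps F
  in IsAlgebraicallyClosed → CharNot2 →
     (m : ℕ) (y : Carrier) → ¬ (y ≈ 0#) → ¬ (y ≈ - 1#) →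
     (α β : ℕ → ℕ → Carrier) →
     f (α 0 0) ≈ y →
     β 0 0 ≈ - α 0 0 →
     ((i j : ℕ) → 1 ≤ i → i ≤ m → j < 2 ℕ.^ i →
       (iter (2 ℕ.* i ℕ.+ 1) f (α i j) ≈ y) × (iter (2 ℕ.* i ℕ.+ 1) f (β i j) ≈ y)) →
     ((i ℓ' : ℕ) → 1 ≤ i → i ≤ m → ℓ' < 2 ℕ.^ (i ∸ 1) → (z : Carrier) →
       ((f (f z) ≈ α (i ∸ 1) ℓ') →
          (z ≈ α i (2 ℕ.* ℓ')) ⊎ (z ≈ - α i (2 ℕ.* ℓ')) ⊎
          (z ≈ α i (2 ℕ.* ℓ' ℕ.+ 1)) ⊎ (z ≈ - α i (2 ℕ.* ℓ' ℕ.+ 1)))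
       × (((z ≈ α i (2 ℕ.* ℓ')) ⊎ (z ≈ - α i (2 ℕ.* ℓ')) ⊎
           (z ≈ α i (2 ℕ.* ℓ' ℕ.+ 1)) ⊎ (z ≈ - α i (2 ℕ.* ℓ' ℕ.+ 1))) →
          f (f z) ≈ α (i ∸ 1) ℓ')) →
     ((i ℓ' : ℕ) → 1 ≤ i → i ≤ m → ℓ' < 2 ℕ.^ (i ∸ 1) → (z : Carrier) →
       ((f (f z) ≈ β (i ∸ 1) ℓ') →
          (z ≈ β i (2 ℕ.* ℓ')) ⊎ (z ≈ - β i (2 ℕ.* ℓ')) ⊎
          (z ≈ β i (2 ℕ.* ℓ' ℕ.+ 1)) ⊎ (z ≈ - β i (2 ℕ.* ℓ' ℕ.+ 1)))
       × (((z ≈ β i (2 ℕ.* ℓ')) ⊎ (z ≈ - β i (2 ℕ.* ℓ')) ⊎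
           (z ≈ β i (2 ℕ.* ℓ' ℕ.+ 1)) ⊎ (z ≈ - β i (2 ℕ.* ℓ' ℕ.+ 1))) →
          f (f z) ≈ β (i ∸ 1) ℓ')) →
     let γ = prod (2 ℕ.^ m) (α m)
         δ = prod (2 ℕ.^ m) (β m)
     in ((- γ) ^ (2 ℕ.^ m) ≈ β 0 0)
        × ((- δ) ^ (2 ℕ.^ m) ≈ α 0 0)
        × Σ (¬ (δ ≈ 0#)) (λ δ≉0 →
            IsPrimitiveRootOfUnity (2 ℕ.^ (suc m)) (γ * Field.inv F δ δ≉0))
-- Neither y ≉ 0 nor the condition f^(2i+1)(αᵢⱼ) = y is needed: the descriptions
-- of the fibres of f ∘ f already determine each level of the tree.
lemma1p2 F closed char≢2 m y _ y≉-1 α β f[α₀]≈y β₀≈-α₀ _ treeα treeβ =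
  [-γ]^N≈β₀ , [-δ]^N≈α₀ , ratio-primitive char≢2 m α₀≉0 [-γ]^N≈-α₀ [-δ]^N≈α₀
  where
  open Field F
  open FieldOps F
  open FieldLemmas F
  open RingProperties ring using (-‿involutive)

  N : ℕ
  N = 2 ℕ.^ m

  γ δ : Carrier
  γ = prod N (α m)
  δ = prod N (β m)

  [-γ]^N≈-α₀ : (- γ) ^ N ≈ - α 0 0
  [-γ]^N≈-α₀ = [-levelProd]^[2^k]≈-α₀ char≢2 (square-root closed) α treeα ℕₚ.≤-refl

  [-γ]^N≈β₀ : (- γ) ^ N ≈ β 0 0
  [-γ]^N≈β₀ = trans [-γ]^N≈-α₀ (sym β₀≈-α₀)

  [-δ]^N≈α₀ : (- δ) ^ N ≈ α 0 0
  [-δ]^N≈α₀ = trans ([-levelProd]^[2^k]≈-α₀ char≢2 (square-root closed) β treeβ ℕₚ.≤-refl)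
                    (trans (-‿cong β₀≈-α₀) (-‿involutive _))

  α₀≉0 : ¬ α 0 0 ≈ 0#
  α₀≉0 = f[x]≈y⇒x≉0 f[α₀]≈y y≉-1
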